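{- Run the Two-Thirds approximation algorithm (described in the context) on $G=(V,E,\phi)$. Let $(u,v)$ be a matched edge of the current matching $M$ at some step of the algorithm, and let $w=HUN(v)$ be a heaviest unmatched neighbor of $v$ at that step. Suppose that in a later augmentation step the matched edge $(u,v)$ is changed to a matched edge $(u,v')$, and let $w'=HUN(v')$ be a heaviest unmatched neighbor of $v'$ (with respect to the matching after that step). Then $\phi(w)\ge\phi(w')$.
   Context: $G=(V,E,\phi)$ is an undirected graph with non-negative vertex weights $\phi$. A matching is a set of edges with no common endpoints; a vertex is matched if it lies on a matching edge, otherwise unmatched. An $M$-augmenting path alternates between non-$M$ and $M$ edges and has two unmatched endpoints; augmenting replaces $M$ by $M\oplus P$. For a vertex $x$, $HUN(x)$ denotes a heaviest neighbor of $x$ that is unmatched in the current matching. The Two-Thirds approximation algorithm: sort the vertices in non-increasing weight order (ties broken consistently) into a queue $Q$; start with $M=\emptyset$; repeatedly remove the heaviest vertex $u$ from $Q$, find a heaviest unmatched vertex $v$ reachable from $u$ by an $M$-augmenting path $P$ of length at most three, and if one exists set $M\gets M\oplus P$ and remove $v$ from $Q$; stop when $Q$ is empty.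
   Formalization: The vertex weights $\phi$ take values in the non-negative rationals instead of the non-negative reals. -}

module Defs where

open import Data.Nat using (ℕ; suc; _<_)
open import Data.Fin using (Fin; _≟_)
open import Data.Maybe using (Maybe; just; nothing)
open import Data.List using (List; []; _∷_; filter; allFin)
open import Data.List.Relation.Unary.Linked using (Linked)
open import Data.List.Relation.Binary.Permutation.Propositional using (_↭_)
open import Data.Product using (_×_; _,_; Σ)
open import Data.Rational using (ℚ; _≤_)
open import Relation.Nullary using (¬_; yes; no; ¬?)
open import Relation.Binary.PropositionalEquality using (_≡_)

record Graph (n : ℕ) : Set₁ where
  field
    E     : Fin n → Fin n → Set
    sym   : ∀ {x y} → E x y → E y x
    irrefl : ∀ {x} → ¬ E x x

-- A matching represented by its partner function: mate x = just y iff (x,y) ∈ M.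
Mating : ℕ → Set
Mating n = Fin n → Maybe (Fin n)

emptyMating : ∀ {n} → Mating n
emptyMating _ = nothing

Unmatched : ∀ {n} → Mating n → Fin n → Set
Unmatched M x = M x ≡ nothing

set : ∀ {n} → Fin n → Fin n → Mating n → Mating n
set x y M z with z ≟ x
... | yes _ = just y
... | no  _ = M z

module _ {n : ℕ} (G : Graph n) where
  open Graph G

  data Aug (M : Mating n) (u : Fin n) : Fin n → Set where
    len1 : ∀ {v} → E u v → Unmatched M u → Unmatched M v → Aug M u v
    len3 : ∀ {a b v} → E u a → M a ≡ just b → E b v →
           Unmatched M u → Unmatched M v → ¬ (u ≡ v) → Aug M u v

  augment : ∀ {M u v} → Aug M u v → Mating n
  augment {M} {u} {v} (len1 _ _ _) = set u v (set v u M)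
  augment {M} {u} {v} (len3 {a} {b} _ _ _ _ _ _) =
    set u a (set a u (set b v (set v b M)))

  module _ (φ : Fin n → ℚ) where

    IsHUN : Mating n → Fin n → Fin n → Set
    IsHUN M x w = E x w × Unmatched M w ×
                  (∀ z → E x z → Unmatched M z → φ z ≤ φ w)

    State : Set
    State = Mating n × List (Fin n)

    remove : Fin n → List (Fin n) → List (Fin n)
    remove v = filter (λ x → ¬? (x ≟ v))

    data Step : State → State → Set where
      augStep : ∀ {M u Q v} (P : Aug M u v) →
                (∀ v' → Aug M u v' → φ v' ≤ φ v) →
                Step (M , u ∷ Q) (augment P , remove v Q)
      noStep  : ∀ {M u Q} → (∀ v' → ¬ Aug M u v') →
                Step (M , u ∷ Q) (M , Q)

    IsInitialQueue : List (Fin n) → Set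
    IsInitialQueue order = (order ↭ allFin n) × Linked (λ x y → φ y ≤ φ x) order

    IsRun : List (Fin n) → (ℕ → State) → ℕ → Set
    IsRun order s T = (s 0 ≡ (emptyMating , order)) ×
                      (∀ t → t < T → Step (s t) (s (suc t)))

module Submission where

-- Along a run three invariants hold: the partner function is a matching of G,
-- every processed vertex that is still unmatched has no unmatched neighbour
-- ("settled"), and the queue stays sorted by weight.  Only a length-three
-- augmentation u₀ – a = b – v₀ can change an existing partner, and only at its
-- interior vertices a, b.  If u = a then v' = u₀ and w' is reachable from u₀
-- by a length-one path, so φ w' ≤ φ v₀ by the choice of v₀; if u = b then
-- v' = v₀, and w' is unmatched with an unmatched neighbour, so it is still in
-- the queue headed by u₀ and φ w' ≤ φ u₀.  In both cases v has an unmatched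
-- neighbour z (v₀ resp. u₀) with φ w' ≤ φ z.  Since matched vertices never
-- become unmatched again, z was already unmatched at the earlier time, so
-- φ z ≤ φ w by the choice of w.

open import Defs
open import Data.Nat using (ℕ; zero; suc; _≤_; _<_; _≤′_; ≤′-refl; ≤′-step)
open import Data.Nat.Properties using (<⇒≤; ≤⇒≤′) renaming (≤-refl to ≤ⁿ-refl)
open import Data.Fin using (Fin; _≟_)
open import Data.Maybe using (just)
open import Data.Maybe.Properties using (just-injective)
open import Data.Product using (∃; _×_; _,_; proj₁; proj₂)
open import Data.Empty using (⊥; ⊥-elim)
open import Data.List using (List; _∷_)
open import Data.List.Membership.Propositional using (_∈_; _∉_)
open import Data.List.Membership.Propositional.Properties using (∈-filter⁺; ∈-allFin)
open import Data.List.Relation.Unary.Any using (here; there)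
open import Data.List.Relation.Unary.All using (lookup)
open import Data.List.Relation.Unary.Linked using (Linked) renaming (tail to Linked-tail)
open import Data.List.Relation.Unary.Linked.Properties using (Linked⇒All; filter⁺)
open import Data.List.Relation.Binary.Permutation.Propositional using (↭-sym)
open import Data.List.Relation.Binary.Permutation.Propositional.Properties using (∈-resp-↭)
open import Data.Rational using (ℚ; 0ℚ) renaming (_≤_ to _≤ℚ_)
open import Data.Rational.Properties using (≤-refl; ≤-trans)
open import Relation.Nullary using (¬_; Dec; yes; no; ¬?)
open import Relation.Binary.PropositionalEquality using (_≡_; _≢_; ≢-sym; refl; sym; trans)

module _ {n : ℕ} where

  link : Fin n → Fin n → Mating n → Mating n
  link x y M = set x y (set y x M)

  set-here : ∀ x y (M : Mating n) → set x y M x ≡ just y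
  set-here x y M with x ≟ x
  ... | yes _   = refl
  ... | no x≢x = ⊥-elim (x≢x refl)

  set-there : ∀ {x y z} (M : Mating n) → z ≢ x → set x y M z ≡ M z
  set-there {x} {z = z} M z≢x with z ≟ x
  ... | yes z≡x = ⊥-elim (z≢x z≡x)
  ... | no _    = refl

  set-unmatched : ∀ {x y z} (M : Mating n) → Unmatched (set x y M) z → Unmatched M z
  set-unmatched {x} {z = z} M h with z ≟ x
  set-unmatched M () | yes _
  set-unmatched M h  | no _ = h

  link-unmatched : ∀ x y {z} (M : Mating n) → Unmatched (link x y M) z → Unmatched M z
  link-unmatched x y {z} M h =
    set-unmatched {y} {x} {z} M (set-unmatched {x} {y} {z} (set y x M) h)

  link-fst : ∀ x y (M : Mating n) → link x y M x ≡ just y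
  link-fst x y M = set-here x y (set y x M)

  link-snd : ∀ x y (M : Mating n) → x ≢ y → link x y M y ≡ just x
  link-snd x y M x≢y = trans (set-there (set y x M) (≢-sym x≢y)) (set-here y x M)

  link-off : ∀ {x y z} (M : Mating n) → z ≢ x → z ≢ y → link x y M z ≡ M z
  link-off {x} {y} M z≢x z≢y = trans (set-there (set y x M) z≢x) (set-there M z≢y)

  unmatched≢matched : ∀ (M : Mating n) {x y t} → Unmatched M x → M y ≡ just t → x ≢ y
  unmatched≢matched M x∅ y↦t refl with trans (sym x∅) y↦t
  ... | ()

  matched≢unmatched : ∀ (M : Mating n) {x y t} → M x ≡ just t → Unmatched M y → x ≢ y
  matched≢unmatched M x↦t y∅ x≡y = unmatched≢matched M y∅ x↦t (sym x≡y)

  same-partner : ∀ (M : Mating n) {x y y'} → M x ≡ just y → M x ≡ just y' → y ≡ y'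
  same-partner M x↦y x↦y' = just-injective (trans (sym x↦y) x↦y')

module _ {n : ℕ} (G : Graph n) where
  open Graph G renaming (sym to E-sym)

  IsMatching : Mating n → Set
  IsMatching M = ∀ {x y} → M x ≡ just y → E x y × M y ≡ just x

  adjacent-distinct : ∀ {x y} → E x y → x ≢ y
  adjacent-distinct e refl = irrefl e

  link-matching : ∀ {M x y} → IsMatching M → E x y → Unmatched M x → Unmatched M y →
                  IsMatching (link x y M)
  link-matching {M} {x} {y} isM e x∅ y∅ {z} {t} z↦t with z ≟ x
  ... | yes refl with refl ← just-injective z↦t = e , link-snd x y M (adjacent-distinct e)
  ... | no _ with z ≟ y
  ...   | yes refl with refl ← just-injective z↦t = E-sym e , link-fst x y M
  ...   | no _ =
    let (zt , t↦z) = isM z↦t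
    in zt , trans (link-off M (matched≢unmatched M t↦z x∅) (matched≢unmatched M t↦z y∅)) t↦z

  module Length3 {M : Mating n} {u a b v : Fin n} (isM : IsMatching M)
                 (ua : E u a) (a↦b : M a ≡ just b) (bv : E b v)
                 (u∅ : Unmatched M u) (v∅ : Unmatched M v) (u≢v : u ≢ v) where

    N : Mating n
    N = link u a (link b v M)

    b↦a : M b ≡ just a
    b↦a = proj₂ (isM a↦b)

    u≢a : u ≢ a
    u≢a = unmatched≢matched M u∅ a↦b

    v≢a : v ≢ a
    v≢a = unmatched≢matched M v∅ a↦b

    b≢u : b ≢ u
    b≢u = matched≢unmatched M b↦a u∅

    b≢v : b ≢ v
    b≢v = matched≢unmatched M b↦a v∅

    b≢a : b ≢ a
    b≢a = adjacent-distinct (proj₁ (isM b↦a))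

    at-u : N u ≡ just a
    at-u = link-fst u a _

    at-a : N a ≡ just u
    at-a = link-snd u a _ u≢a

    at-b : N b ≡ just v
    at-b = trans (link-off _ b≢u b≢a) (link-fst b v M)

    at-v : N v ≡ just b
    at-v = trans (link-off _ (≢-sym u≢v) v≢a) (link-snd b v M b≢v)

    elsewhere : ∀ {z} → z ≢ u → z ≢ a → z ≢ b → z ≢ v → N z ≡ M z
    elsewhere z≢u z≢a z≢b z≢v = trans (link-off _ z≢u z≢a) (link-off M z≢b z≢v)

    matching : IsMatching N
    matching {z} {t} z↦t with z ≟ u
    ... | yes refl with refl ← just-injective z↦t = ua , at-a
    ... | no _ with z ≟ a
    ...   | yes refl with refl ← just-injective z↦t = E-sym ua , at-u
    ...   | no z≢a with z ≟ b
    ...     | yes refl with refl ← just-injective z↦t = bv , at-v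
    ...     | no z≢b with z ≟ v
    ...       | yes refl with refl ← just-injective z↦t = E-sym bv , at-b
    ...       | no _ =
      let (zt , t↦z) = isM z↦t
      in zt , trans (elsewhere (matched≢unmatched M t↦z u∅)
                               (λ { refl → z≢b (same-partner M t↦z a↦b) })
                               (λ { refl → z≢a (same-partner M t↦z b↦a) })
                               (matched≢unmatched M t↦z v∅)) t↦z

  augment-matching : ∀ {M u v} → IsMatching M → (P : Aug G M u v) → IsMatching (augment G P)
  augment-matching isM (len1 e u∅ v∅) = link-matching isM e u∅ v∅
  augment-matching isM (len3 ua a↦b bv u∅ v∅ u≢v) = Length3.matching isM ua a↦b bv u∅ v∅ u≢v

  augment-unmatched : ∀ {M u v z} (P : Aug G M u v) → Unmatched (augment G P) z → Unmatched M z
  augment-unmatched {M} {u} {v} {z} (len1 _ _ _) z∅ = link-unmatched u v {z} M z∅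
  augment-unmatched {M} {u} {v} {z} (len3 {a} {b} _ _ _ _ _ _) z∅ =
    link-unmatched b v {z} M (link-unmatched u a {z} (link b v M) z∅)

  augment-ends-matched : ∀ {M u v z} → IsMatching M → (P : Aug G M u v) →
                         Unmatched (augment G P) z → z ≢ u × z ≢ v
  augment-ends-matched {M} {u} {v} {z} _ (len1 e _ _) z∅ =
    unmatched≢matched (link u v M) {z} z∅ (link-fst u v M) ,
    unmatched≢matched (link u v M) {z} z∅ (link-snd u v M (adjacent-distinct e))
  augment-ends-matched {z = z} isM (len3 ua a↦b bv u∅ v∅ u≢v) z∅ =
    unmatched≢matched N {z} z∅ at-u , unmatched≢matched N {z} z∅ at-v
    where open Length3 isM ua a↦b bv u∅ v∅ u≢v

  module _ (φ : Fin n → ℚ) where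

    _≽_ : Fin n → Fin n → Set
    x ≽ y = φ y ≤ℚ φ x

    ≽-trans : ∀ {x y z} → x ≽ y → y ≽ z → x ≽ z
    ≽-trans x≽y y≽z = ≤-trans y≽z x≽y

    -- A processed vertex that is still unmatched has no unmatched neighbour:
    -- otherwise a length-one augmenting path would have been found for it.
    Settled : State G φ → Set
    Settled (M , Q) = ∀ {x z} → x ∉ Q → Unmatched M x → E x z → Unmatched M z → ⊥

    record Invariant (st : State G φ) : Set where
      field
        matching : IsMatching (proj₁ st)
        settled  : Settled st
        sorted   : Linked _≽_ (proj₂ st)

    waiting-in-queue : ∀ {M Q x z} → Settled (M , Q) →
                       Unmatched M x → E x z → Unmatched M z → x ∈ Q
    waiting-in-queue {Q = Q} {x} settled x∅ xz z∅ with x ∈? Q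
      where open import Data.List.Membership.DecPropositional (_≟_ {n}) using (_∈?_)
    ... | yes x∈Q = x∈Q
    ... | no  x∉Q = ⊥-elim (settled x∉Q x∅ xz z∅)

    head-heaviest : ∀ {u Q x} → Linked _≽_ (u ∷ Q) → x ∈ u ∷ Q → u ≽ x
    head-heaviest {u} sorted = lookup (Linked⇒All ≽-trans (≤-refl {φ u}) sorted)

    step-preserves : ∀ {st st'} → Step G φ st st' → Invariant st → Invariant st'
    step-preserves {M , u ∷ Q} (noStep no-path) inv = record
      { matching = matching ; settled = settled' ; sorted = Linked-tail sorted }
      where
      open Invariant inv
      settled' : Settled (M , Q)
      settled' {x} x∉Q x∅ xz z∅ with x ≟ u
      ... | yes refl = no-path _ (len1 xz x∅ z∅)
      ... | no  x≢u  = settled (λ { (here x≡u) → x≢u x≡u ; (there x∈Q) → x∉Q x∈Q }) x∅ xz z∅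
    step-preserves {M , u ∷ Q} (augStep {v = v} P _) inv = record
      { matching = augment-matching matching P
      ; settled  = settled'
      ; sorted   = filter⁺ (λ x → ¬? (x ≟ v)) ≽-trans (Linked-tail sorted) }
      where
      open Invariant inv
      settled' : Settled (augment G P , remove G φ v Q)
      settled' {x} x∉Q' x∅ xz z∅ =
        settled x∉u∷Q (augment-unmatched P x∅) xz (augment-unmatched P z∅)
        where
        x≢u×x≢v = augment-ends-matched matching P x∅
        x∉u∷Q : x ∉ u ∷ Q
        x∉u∷Q (here x≡u)   = proj₁ x≢u×x≢v x≡u
        x∉u∷Q (there x∈Q) = x∉Q' (∈-filter⁺ (λ y → ¬? (y ≟ v)) x∈Q (proj₂ x≢u×x≢v))

    step-unmatched : ∀ {st st' x} → Step G φ st st' →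
                     Unmatched (proj₁ st') x → Unmatched (proj₁ st) x
    step-unmatched (augStep P _) x∅ = augment-unmatched P x∅
    step-unmatched (noStep _)    x∅ = x∅

    rematch-bound : ∀ {st st' x y y' w'} → Step G φ st st' → Invariant st →
                    proj₁ st x ≡ just y → proj₁ st' x ≡ just y' → y' ≢ y →
                    E y' w' → Unmatched (proj₁ st') w' →
                    ∃ λ z → E y z × Unmatched (proj₁ st) z × z ≽ w'
    rematch-bound {M , _} (noStep _) _ x↦y x↦y' y'≢y _ _ =
      ⊥-elim (y'≢y (same-partner M x↦y' x↦y))
    rematch-bound {M , _} {x = x} (augStep {u = u} {v = v} (len1 _ u∅ v∅) _) _
                  x↦y x↦y' y'≢y _ _ =
      ⊥-elim (y'≢y (same-partner (link u v M) {x} x↦y' (trans unchanged x↦y)))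
      where
      unchanged : link u v M x ≡ M x
      unchanged = link-off M (matched≢unmatched M x↦y u∅) (matched≢unmatched M x↦y v∅)
    rematch-bound {M , u ∷ Q} {x = x} {y} {y'} {w'}
                  (augStep P@(len3 {a} {b} {v} ua a↦b bv u∅ v∅ u≢v) v-heaviest) inv
                  x↦y x↦y' y'≢y y'w' w'∅ = by-position (x ≟ a) (x ≟ b)
      where
      open Invariant inv
      open Length3 matching ua a↦b bv u∅ v∅ u≢v
      w'∅ᴹ : Unmatched M w'
      w'∅ᴹ = augment-unmatched P w'∅
      -- Only the interior vertices a, b of the path change partner.
      by-position : Dec (x ≡ a) → Dec (x ≡ b) → ∃ λ z → E y z × Unmatched M z × z ≽ w'
      -- x = a: y = b and y' = u, so u – w' is an augmenting path and v was chosen heaviest.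
      by-position (yes refl) _
        with refl ← same-partner M x↦y a↦b | refl ← same-partner N {a} x↦y' at-a =
        v , bv , v∅ , v-heaviest w' (len1 y'w' u∅ w'∅ᴹ)
      -- x = b: y = a and y' = v; w' is unmatched with the unmatched neighbour v,
      -- so it is still queued behind the head u.
      by-position (no _) (yes refl)
        with refl ← same-partner M x↦y b↦a | refl ← same-partner N {b} x↦y' at-b =
        u , E-sym ua , u∅ ,
        head-heaviest sorted (waiting-in-queue settled w'∅ᴹ (E-sym y'w') v∅)
      by-position (no x≢a) (no x≢b) =
        ⊥-elim (y'≢y (same-partner N {x} x↦y' (trans unchanged x↦y)))
        where
        unchanged : N x ≡ M x
        unchanged = elsewhere (matched≢unmatched M x↦y u∅) x≢a x≢b (matched≢unmatched M x↦y v∅)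

    module Run {order : List (Fin n)} (initial : IsInitialQueue G φ order)
               {s : ℕ → State G φ} {T : ℕ} (run : IsRun G φ order s T) where

      step : ∀ t → t < T → Step G φ (s t) (s (suc t))
      step = proj₂ run

      initial-invariant : Invariant (emptyMating , order)
      initial-invariant = record
        { matching = λ ()
        ; settled  = λ {x} x∉order _ _ _ →
                       x∉order (∈-resp-↭ (↭-sym (proj₁ initial)) (∈-allFin x))
        ; sorted   = proj₂ initial
        }

      invariant : ∀ t → t ≤ T → Invariant (s t)
      invariant zero    _   rewrite proj₁ run = initial-invariant
      invariant (suc t) t<T = step-preserves (step t t<T) (invariant t (<⇒≤ t<T))

      unmatched-earlier : ∀ {k t x} → k ≤′ t → t ≤ T →
                          Unmatched (proj₁ (s t)) x → Unmatched (proj₁ (s k)) x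
      unmatched-earlier ≤′-refl          _   x∅ = x∅
      unmatched-earlier (≤′-step k≤′t) t≤T x∅ =
        unmatched-earlier k≤′t (<⇒≤ t≤T) (step-unmatched (step _ t≤T) x∅)

-- Step j yields a neighbour z of v, unmatched before the step, with φ w' ≤ φ z;
-- z was unmatched at time i too, so φ z ≤ φ w.
lemma1 : ∀ {n} (G : Graph n) (φ : Fin n → ℚ) → (∀ x → 0ℚ ≤ℚ φ x) →
    ∀ order → IsInitialQueue G φ order →
    ∀ (s : ℕ → State G φ) (T : ℕ) → IsRun G φ order s T →
    ∀ (i j : ℕ) (u v v' w w' : Fin n) → i ≤ j → suc j ≤ T →
    (∀ k → i ≤ k → k ≤ j → proj₁ (s k) u ≡ just v) →
    proj₁ (s (suc j)) u ≡ just v' → ¬ (v' ≡ v) →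
    IsHUN G φ (proj₁ (s i)) v w →
    IsHUN G φ (proj₁ (s (suc j))) v' w' →
    φ w' ≤ℚ φ w
lemma1 G φ _ order initial s T run i j u v v' w w' i≤j j<T u↦v u↦v' v'≢v
       (_ , _ , w-heaviest) (v'w' , w'∅ , _) =
  let (z , vz , z∅ , z≽w') = rematch-bound G φ (step j j<T) (invariant j (<⇒≤ j<T))
                                           (u↦v j i≤j ≤ⁿ-refl) u↦v' v'≢v v'w' w'∅
  in ≤-trans z≽w' (w-heaviest z vz (unmatched-earlier (≤⇒≤′ i≤j) (<⇒≤ j<T) z∅))
  where open Run G φ initial run
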